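{- Let $H=(V,E)$ be an oriented hypergraph that has an algebraic spanning tree over the integers. Then $H_1\cong H^1$ over the integers.
   Context: An oriented hypergraph $H=(V,E)$ consists of a finite set $V$ and a set $E$ of ordered pairs $(A,B)$ of disjoint subsets of $V$, where $E$ never contains both $(A,B)$ and $(B,A)$. $C_0,C_1$ are the free $\mathbb Z$-modules with bases $V,E$; $\partial_1\colon C_1\to C_0$ is the linear extension of $(A,B)\mapsto\sum_{v\in B}v-\sum_{v\in A}v$; $C^0=\mathrm{Hom}(C_0,\mathbb Z)$, $C^1=\mathrm{Hom}(C_1,\mathbb Z)$; $\delta^0(\varphi)=\varphi\circ\partial_1$. $H_1:=\operatorname{Ker}\partial_1$ and $H^1:=C^1/\operatorname{Im}\delta^0$. $\gamma_1\colon C_1\to C^1$ with $\gamma_1(e)(e')=\delta_{ee'}$; $\langle\,,\rangle$ is the bilinear form on $C_1$ with $\langle e,e'\rangle=\delta_{ee'}$; $\mathcal C:=\operatorname{Ker}\partial_1$, $\mathcal B:=\gamma_1^{ -1}(\operatorname{Im}\delta^0)$. $T\subseteq E$ is an algebraic spanning tree over the integers if (1) $\mathcal B$ has a $\mathbb Z$-basis $(x_t\mid t\in T)$ with $\langle x_t,t'\rangle=\delta_{tt'}$ for all $t,t'\in T$, and (2) $\mathcal C$ has a $\mathbb Z$-basis $(x_e\mid e\in E\setminus T)$ with $\langle x_e,e'\rangle=\delta_{ee'}$ for all $e,e'\in E\setminus T$. -}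

module Defs where

open import Data.Nat using (ℕ; zero; suc)
open import Data.Integer using (ℤ; 0ℤ; 1ℤ; _+_; _-_; _*_)
open import Data.Fin using (Fin; zero; suc; _≟_)
open import Data.Fin.Subset using (Subset; _∈_; _∉_; ∁)
open import Data.Vec using (lookup)
open import Data.Bool using (Bool; true; false; if_then_else_)
open import Data.Product using (Σ; Σ-syntax; _×_; _,_; proj₁; proj₂; swap)
open import Relation.Binary.PropositionalEquality using (_≡_; _≢_)
open import Relation.Nullary using (¬_; yes; no)
open import Function.Definitions using (Injective)

Σℤ : (n : ℕ) → (Fin n → ℤ) → ℤ
Σℤ zero    f = 0ℤ
Σℤ (suc n) f = f zero + Σℤ n (λ i → f (suc i))

ind : Bool → ℤ
ind true  = 1ℤ
ind false = 0ℤ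

δ : {n : ℕ} → Fin n → Fin n → ℤ
δ i j with i ≟ j
... | yes _ = 1ℤ
... | no  _ = 0ℤ

record OrientedHypergraph : Set where
  field
    n m       : ℕ
    edge      : Fin m → Subset n × Subset n
    disjoint  : ∀ e v → ¬ (v ∈ proj₁ (edge e) × v ∈ proj₂ (edge e))
    -- E is a set: distinct edge indices denote distinct pairs
    distinct  : Injective _≡_ _≡_ edge
    noReverse : ∀ e e' → e ≢ e' → edge e' ≢ swap (edge e)

module _ (H : OrientedHypergraph) where
  open OrientedHypergraph H

  C₀ : Set
  C₀ = Fin n → ℤ

  C₁ : Set
  C₁ = Fin m → ℤ

  -- cochains C⁰ = Hom(C₀,ℤ), C¹ = Hom(C₁,ℤ), represented by their values on the bases
  C⁰ : Set
  C⁰ = Fin n → ℤ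

  C¹ : Set
  C¹ = Fin m → ℤ

  eval₀ : C⁰ → C₀ → ℤ
  eval₀ φ c = Σℤ n (λ v → φ v * c v)

  basis₁ : Fin m → C₁
  basis₁ e = δ e

  -- ∂₁(A,B) = Σ_{v∈B} v − Σ_{v∈A} v, coefficient of v
  incidence : Fin m → Fin n → ℤ
  incidence e v = ind (lookup (proj₂ (edge e)) v) - ind (lookup (proj₁ (edge e)) v)

  ∂₁ : C₁ → C₀
  ∂₁ x v = Σℤ m (λ e → x e * incidence e v)

  -- δ⁰(φ) = φ ∘ ∂₁, as an element of C¹ (values on basis edges)
  δ⁰ : C⁰ → C¹
  δ⁰ φ e = eval₀ φ (∂₁ (basis₁ e))

  -- γ₁(e)(e') = δ_{ee'}; on the basis representation this is the identity
  γ₁ : C₁ → C¹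
  γ₁ x e' = x e'

  ⟨_,_⟩ : C₁ → C₁ → ℤ
  ⟨ x , y ⟩ = Σℤ m (λ e → x e * y e)

  InImδ⁰ : C¹ → Set
  InImδ⁰ c = Σ[ φ ∈ C⁰ ] (∀ e → c e ≡ δ⁰ φ e)

  𝒞 : C₁ → Set
  𝒞 x = ∀ v → ∂₁ x v ≡ 0ℤ

  ℬ : C₁ → Set
  ℬ x = InImδ⁰ (γ₁ x)

  lincomb : Subset m → (Fin m → ℤ) → (Fin m → C₁) → C₁
  lincomb I c x e = Σℤ m (λ i → if lookup I i then c i * x i e else 0ℤ)

  record IsZBasis (P : C₁ → Set) (I : Subset m) (x : Fin m → C₁) : Set where
    field
      members : ∀ i → i ∈ I → P (x i)
      spans   : ∀ y → P y → Σ[ c ∈ (Fin m → ℤ) ] (∀ e → y e ≡ lincomb I c x e)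
      indep   : ∀ (c : Fin m → ℤ) → (∀ e → lincomb I c x e ≡ 0ℤ) → ∀ i → i ∈ I → c i ≡ 0ℤ

  AlgebraicSpanningTree : Subset m → Set
  AlgebraicSpanningTree T =
    Σ[ x ∈ (Fin m → C₁) ]
      (IsZBasis ℬ T x × (∀ t t' → t ∈ T → t' ∈ T → ⟨ x t , basis₁ t' ⟩ ≡ δ t t'))
    × Σ[ y ∈ (Fin m → C₁) ]
      (IsZBasis 𝒞 (∁ T) y × (∀ e e' → e ∉ T → e' ∉ T → ⟨ y e , basis₁ e' ⟩ ≡ δ e e'))

  -- equality in H¹ = C¹ / Im δ⁰
  _~_ : C¹ → C¹ → Set
  a ~ b = InImδ⁰ (λ e → a e - b e)

  -- a group (ℤ-module) isomorphism H₁ = Ker ∂₁ → H¹ = C¹/Im δ⁰,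
  -- given by a representative map f : H₁ → C¹
  record H₁≅H¹ : Set where
    field
      f      : (x : C₁) → 𝒞 x → C¹
      f-cong : ∀ x px y py → (∀ e → x e ≡ y e) → f x px ~ f y py
      f-hom  : ∀ x px y py z pz → (∀ e → z e ≡ x e + y e) →
               f z pz ~ (λ e → f x px e + f y py e)
      f-inj  : ∀ x px y py → f x px ~ f y py → ∀ e → x e ≡ y e
      f-surj : ∀ (c : C¹) → Σ[ x ∈ C₁ ] Σ[ px ∈ 𝒞 x ] (f x px ~ c)

-- The isomorphism sends a cycle x to the class of its restriction to E ∖ T
-- (zero on T).  The bases of ℬ and 𝒞 are dual to the coordinate functionals
-- on T and on E ∖ T respectively, so an element of ℬ (resp. 𝒞) is determined
-- by its coordinates on T (resp. E ∖ T), and any prescribed coordinates on T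
-- (resp. E ∖ T) are attained by some element.  The first fact gives
-- injectivity: a cycle whose restriction lies in ℬ has that restriction zero,
-- hence vanishes off T, hence vanishes.  The second gives surjectivity: a
-- cochain c differs by an element b ∈ ℬ agreeing with c on T from a cochain
-- supported off T, which is the restriction of a cycle.
module Submission where

open import Defs
open import Data.Bool using (true; false; if_then_else_)
open import Data.Empty using (⊥-elim)
open import Data.Fin using (Fin; zero; suc; _≟_)
open import Data.Fin.Properties using (suc-injective)
open import Data.Fin.Subset using (Subset; _∈_; _∉_; ∁)
open import Data.Fin.Subset.Properties using (_∈?_; x∈∁p⇒x∉p; x∉p⇒x∈∁p)
open import Data.Integer using (ℤ; 0ℤ; 1ℤ; -1ℤ; _+_; _-_; _*_; -_)
open import Data.Integer.Properties
  using (+-identityˡ; +-identityʳ; +-inverseʳ; *-zeroʳ; *-identityˡ; *-identityʳ; *-assoc;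
         *-distribˡ-+; *-distribʳ-+; -1*i≡-i; i-j≡0⇒i≡j)
open import Data.Integer.Tactic.RingSolver using (solve-∀)
open import Data.Nat using (zero; suc)
open import Data.Product using (Σ-syntax; _×_; _,_; proj₁; proj₂)
open import Data.Vec using (lookup)
open import Data.Vec.Properties using ([]=⇒lookup; lookup⇒[]=)
open import Function using (_∘_)
open import Relation.Binary.PropositionalEquality
  using (_≡_; _≢_; refl; sym; trans; cong; cong₂; module ≡-Reasoning)
open import Relation.Nullary using (yes; no)

open ≡-Reasoning

Σℤ-cong : ∀ k {f g : Fin k → ℤ} → (∀ i → f i ≡ g i) → Σℤ k f ≡ Σℤ k g
Σℤ-cong zero    f≗g = refl
Σℤ-cong (suc k) f≗g = cong₂ _+_ (f≗g zero) (Σℤ-cong k (λ i → f≗g (suc i)))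

Σℤ-zero : ∀ k {f : Fin k → ℤ} → (∀ i → f i ≡ 0ℤ) → Σℤ k f ≡ 0ℤ
Σℤ-zero zero    f≗0 = refl
Σℤ-zero (suc k) f≗0 = cong₂ _+_ (f≗0 zero) (Σℤ-zero k (λ i → f≗0 (suc i)))

Σℤ-+ : ∀ k (f g : Fin k → ℤ) → Σℤ k (λ i → f i + g i) ≡ Σℤ k f + Σℤ k g
Σℤ-+ zero    f g = refl
Σℤ-+ (suc k) f g = begin
  f zero + g zero + Σℤ k (λ i → f (suc i) + g (suc i))
    ≡⟨ cong (f zero + g zero +_) (Σℤ-+ k _ _) ⟩
  f zero + g zero + (Σℤ k (λ i → f (suc i)) + Σℤ k (λ i → g (suc i)))
    ≡⟨ interchange (f zero) (g zero) _ _ ⟩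
  f zero + Σℤ k (λ i → f (suc i)) + (g zero + Σℤ k (λ i → g (suc i))) ∎
  where
  interchange : ∀ (a b c d : ℤ) → a + b + (c + d) ≡ a + c + (b + d)
  interchange = solve-∀

Σℤ-*ˡ : ∀ k (s : ℤ) (f : Fin k → ℤ) → Σℤ k (λ i → s * f i) ≡ s * Σℤ k f
Σℤ-*ˡ zero    s f = sym (*-zeroʳ s)
Σℤ-*ˡ (suc k) s f =
  trans (cong (s * f zero +_) (Σℤ-*ˡ k s _)) (sym (*-distribˡ-+ s (f zero) _))

Σℤ-single : ∀ k (f : Fin k → ℤ) t → (∀ i → i ≢ t → f i ≡ 0ℤ) → Σℤ k f ≡ f t
Σℤ-single (suc k) f zero    f≗0 =
  trans (cong (f zero +_) (Σℤ-zero k (λ i → f≗0 (suc i) λ ()))) (+-identityʳ (f zero))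
Σℤ-single (suc k) f (suc t) f≗0 = begin
  f zero + Σℤ k (λ i → f (suc i))  ≡⟨ cong (_+ Σℤ k (λ i → f (suc i))) (f≗0 zero λ ()) ⟩
  0ℤ + Σℤ k (λ i → f (suc i))      ≡⟨ +-identityˡ _ ⟩
  Σℤ k (λ i → f (suc i))           ≡⟨ Σℤ-single k _ t (λ i i≢t → f≗0 (suc i) (i≢t ∘ suc-injective)) ⟩
  f (suc t)                        ∎

Σℤ-linear : ∀ k (K : Fin k → ℤ) (s : ℤ) (x y : Fin k → ℤ) →
            Σℤ k (λ j → (x j + s * y j) * K j) ≡ Σℤ k (λ j → x j * K j) + s * Σℤ k (λ j → y j * K j)
Σℤ-linear k K s x y = begin
  Σℤ k (λ j → (x j + s * y j) * K j)
    ≡⟨ Σℤ-cong k (λ j → trans (*-distribʳ-+ (K j) (x j) _) (cong (x j * K j +_) (*-assoc s (y j) (K j)))) ⟩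
  Σℤ k (λ j → x j * K j + s * (y j * K j))
    ≡⟨ Σℤ-+ k _ _ ⟩
  Σℤ k (λ j → x j * K j) + Σℤ k (λ j → s * (y j * K j))
    ≡⟨ cong (Σℤ k (λ j → x j * K j) +_) (Σℤ-*ˡ k s _) ⟩
  Σℤ k (λ j → x j * K j) + s * Σℤ k (λ j → y j * K j) ∎

δ-refl : ∀ {n} (i : Fin n) → δ i i ≡ 1ℤ
δ-refl i with i ≟ i
... | yes _   = refl
... | no  i≢i = ⊥-elim (i≢i refl)

δ-≢ : ∀ {n} {i j : Fin n} → i ≢ j → δ i j ≡ 0ℤ
δ-≢ {i = i} {j} i≢j with i ≟ j
... | yes i≡j = ⊥-elim (i≢j i≡j)
... | no  _   = refl

if-∈ : ∀ {n} {I : Subset n} {i} {a b : ℤ} → i ∈ I → (if lookup I i then a else b) ≡ a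
if-∈ i∈I rewrite []=⇒lookup i∈I = refl

if-∉ : ∀ {n} {I : Subset n} {i} {a b : ℤ} → i ∉ I → (if lookup I i then a else b) ≡ b
if-∉ {I = I} {i} i∉I with lookup I i in eq
... | true  = ⊥-elim (i∉I (lookup⇒[]= i I eq))
... | false = refl

module _ (H : OrientedHypergraph) where
  open OrientedHypergraph H

  ⟨-,basis₁⟩ : ∀ (x : C₁ H) t → ⟨_,_⟩ H x (basis₁ H t) ≡ x t
  ⟨-,basis₁⟩ x t = begin
    Σℤ m (λ e → x e * δ t e) ≡⟨ Σℤ-single m _ t off-t ⟩
    x t * δ t t              ≡⟨ cong (x t *_) (δ-refl t) ⟩
    x t * 1ℤ                 ≡⟨ *-identityʳ (x t) ⟩
    x t                      ∎
    where
    off-t : ∀ e → e ≢ t → x e * δ t e ≡ 0ℤ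
    off-t e e≢t = trans (cong (x e *_) (δ-≢ (e≢t ∘ sym))) (*-zeroʳ (x e))

  record IsSubmodule (P : C₁ H → Set) : Set where
    field
      0∈        : P (λ _ → 0ℤ)
      ∈-resp    : ∀ {x y} → (∀ e → x e ≡ y e) → P x → P y
      +*-closed : ∀ {x y} (s : ℤ) → P x → P y → P (λ e → x e + s * y e)

    +-closed : ∀ {x y} → P x → P y → P (λ e → x e + y e)
    +-closed {x} {y} px py = ∈-resp (λ e → cong (x e +_) (*-identityˡ (y e))) (+*-closed 1ℤ px py)

    *-closed : ∀ {x} (s : ℤ) → P x → P (λ e → s * x e)
    *-closed s px = ∈-resp (λ e → +-identityˡ _) (+*-closed s 0∈ px)

    neg-closed : ∀ {x} → P x → P (λ e → - x e)
    neg-closed px = ∈-resp (λ e → -1*i≡-i _) (*-closed -1ℤ px)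

    sub-closed : ∀ {x y} → P x → P y → P (λ e → x e - y e)
    sub-closed px py = +-closed px (neg-closed py)

    Σ-closed : ∀ k {x : Fin k → C₁ H} → (∀ i → P (x i)) → P (λ e → Σℤ k (λ i → x i e))
    Σ-closed zero    px = 0∈
    Σ-closed (suc k) px = +-closed (px zero) (Σ-closed k (λ i → px (suc i)))

    lincomb-closed : ∀ I c {x} → (∀ i → i ∈ I → P (x i)) → P (lincomb H I c x)
    lincomb-closed I c {x} px = Σ-closed m term
      where
      term : ∀ i → P (λ e → if lookup I i then c i * x i e else 0ℤ)
      term i with i ∈? I
      ... | yes i∈I = ∈-resp (λ e → sym (if-∈ i∈I)) (*-closed (c i) (px i i∈I))
      ... | no  i∉I = ∈-resp (λ e → sym (if-∉ i∉I)) 0∈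

  ℬ-isSubmodule : IsSubmodule (ℬ H)
  ℬ-isSubmodule = record
    { 0∈        = (λ _ → 0ℤ) , λ e → sym (Σℤ-zero n (λ _ → refl))
    ; ∈-resp    = λ x≗y (φ , x≗δφ) → φ , λ e → trans (sym (x≗y e)) (x≗δφ e)
    ; +*-closed = λ s (φ , x≗δφ) (ψ , y≗δψ) → (λ v → φ v + s * ψ v) ,
        λ e → trans (cong₂ (λ a b → a + s * b) (x≗δφ e) (y≗δψ e)) (sym (Σℤ-linear n _ s φ ψ))
    }

  𝒞-isSubmodule : IsSubmodule (𝒞 H)
  𝒞-isSubmodule = record
    { 0∈        = λ v → Σℤ-zero m (λ _ → refl)
    ; ∈-resp    = λ x≗y ∂x≡0 v → trans (Σℤ-cong m (λ e → cong (_* incidence H e v) (sym (x≗y e)))) (∂x≡0 v)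
    ; +*-closed = λ {x} {y} s ∂x≡0 ∂y≡0 v → begin
        Σℤ m (λ e → (x e + s * y e) * incidence H e v) ≡⟨ Σℤ-linear m _ s x y ⟩
        ∂₁ H x v + s * ∂₁ H y v                        ≡⟨ cong₂ (λ a b → a + s * b) (∂x≡0 v) (∂y≡0 v) ⟩
        0ℤ + s * 0ℤ                                    ≡⟨ cong (0ℤ +_) (*-zeroʳ s) ⟩
        0ℤ                                             ∎
    }

  ≗⇒~ : ∀ {a b : C¹ H} → (∀ e → a e ≡ b e) → _~_ H a b
  ≗⇒~ {a} {b} a≗b = IsSubmodule.∈-resp ℬ-isSubmodule a-b≡0 (IsSubmodule.0∈ ℬ-isSubmodule)
    where
    a-b≡0 : ∀ e → 0ℤ ≡ a e - b e
    a-b≡0 e = sym (trans (cong (λ u → a e - u) (sym (a≗b e))) (+-inverseʳ (a e)))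

  IsDual : Subset m → (Fin m → C₁ H) → Set
  IsDual I x = ∀ i j → i ∈ I → j ∈ I → x i j ≡ δ i j

  lincomb-dual : ∀ {I x} → IsDual I x → ∀ c {t} → t ∈ I → lincomb H I c x t ≡ c t
  lincomb-dual {I} {x} dual c {t} t∈I = begin
    lincomb H I c x t                         ≡⟨ Σℤ-single m _ t off-t ⟩
    (if lookup I t then c t * x t t else 0ℤ)  ≡⟨ if-∈ t∈I ⟩
    c t * x t t                               ≡⟨ cong (c t *_) (trans (dual t t t∈I t∈I) (δ-refl t)) ⟩
    c t * 1ℤ                                  ≡⟨ *-identityʳ (c t) ⟩
    c t                                       ∎
    where
    off-t : ∀ i → i ≢ t → (if lookup I i then c i * x i t else 0ℤ) ≡ 0ℤ
    off-t i i≢t with i ∈? I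
    ... | yes i∈I = trans (if-∈ i∈I) (trans (cong (c i *_) (trans (dual i t i∈I t∈I) (δ-≢ i≢t))) (*-zeroʳ (c i)))
    ... | no  i∉I = if-∉ i∉I

  lincomb-vanishing : ∀ I {c} x → (∀ i → i ∈ I → c i ≡ 0ℤ) → ∀ e → lincomb H I c x e ≡ 0ℤ
  lincomb-vanishing I {c} x c≗0 e = Σℤ-zero m term≡0
    where
    term≡0 : ∀ i → (if lookup I i then c i * x i e else 0ℤ) ≡ 0ℤ
    term≡0 i with i ∈? I
    ... | yes i∈I = trans (if-∈ i∈I) (cong (_* x i e) (c≗0 i i∈I))
    ... | no  i∉I = if-∉ i∉I

  module DualBasis {P I x} (basis : IsZBasis H P I x) (dual : IsDual I x) where
    open IsZBasis basis

    -- By duality, the coefficients of y in the basis x are its coordinates on I.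
    vanishing-on-I⇒zero : ∀ {y} → P y → (∀ i → i ∈ I → y i ≡ 0ℤ) → ∀ e → y e ≡ 0ℤ
    vanishing-on-I⇒zero {y} py y≗0 e = trans (y≡Σcx e) (lincomb-vanishing I x c≗0 e)
      where
      c = proj₁ (spans y py)
      y≡Σcx = proj₂ (spans y py)

      c≗0 : ∀ i → i ∈ I → c i ≡ 0ℤ
      c≗0 i i∈I = trans (sym (lincomb-dual dual c i∈I)) (trans (sym (y≡Σcx i)) (y≗0 i i∈I))

    extend-from-I : IsSubmodule P → ∀ c → Σ[ z ∈ C₁ H ] P z × (∀ i → i ∈ I → z i ≡ c i)
    extend-from-I P-sub c =
      lincomb H I c x , IsSubmodule.lincomb-closed P-sub I c members , λ i i∈I → lincomb-dual dual c i∈I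

  offTree : Subset m → C₁ H → C¹ H
  offTree T x e = if lookup T e then 0ℤ else x e

  offTree-∈ : ∀ {T} x {e} → e ∈ T → offTree T x e ≡ 0ℤ
  offTree-∈ x e∈T = if-∈ e∈T

  offTree-∉ : ∀ {T} x {e} → e ∉ T → offTree T x e ≡ x e
  offTree-∉ x e∉T = if-∉ e∉T

  offTree-cong : ∀ T {x y} → (∀ e → x e ≡ y e) → ∀ e → offTree T x e ≡ offTree T y e
  offTree-cong T x≗y e = cong (if lookup T e then 0ℤ else_) (x≗y e)

  offTree-+ : ∀ T {x y z} → (∀ e → z e ≡ x e + y e) →
              ∀ e → offTree T z e ≡ offTree T x e + offTree T y e
  offTree-+ T {x} {y} {z} z≗x+y e with e ∈? T
  ... | yes e∈T = begin
    offTree T z e                    ≡⟨ offTree-∈ z e∈T ⟩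
    0ℤ + 0ℤ                          ≡⟨ cong₂ _+_ (offTree-∈ x e∈T) (offTree-∈ y e∈T) ⟨
    offTree T x e + offTree T y e    ∎
  ... | no  e∉T = begin
    offTree T z e                    ≡⟨ offTree-∉ z e∉T ⟩
    z e                              ≡⟨ z≗x+y e ⟩
    x e + y e                        ≡⟨ cong₂ _+_ (offTree-∉ x e∉T) (offTree-∉ y e∉T) ⟨
    offTree T x e + offTree T y e    ∎

  ⟨-,basis₁⟩-dual : ∀ {I} {Q : Fin m → Set} {x} → (∀ i → i ∈ I → Q i) →
                   (∀ i j → Q i → Q j → ⟨_,_⟩ H (x i) (basis₁ H j) ≡ δ i j) → IsDual I x
  ⟨-,basis₁⟩-dual {x = x} I⊆Q pairing i j i∈I j∈I =
    trans (sym (⟨-,basis₁⟩ (x i) j)) (pairing i j (I⊆Q i i∈I) (I⊆Q j j∈I))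

  module _ (T : Subset m) {xℬ y𝒞 : Fin m → C₁ H}
           (xℬ-basis : IsZBasis H (ℬ H) T xℬ) (xℬ-dual : IsDual T xℬ)
           (y𝒞-basis : IsZBasis H (𝒞 H) (∁ T) y𝒞) (y𝒞-dual : IsDual (∁ T) y𝒞) where
    private
      module ℬ-basis = DualBasis xℬ-basis xℬ-dual
      module 𝒞-basis = DualBasis y𝒞-basis y𝒞-dual

    offTree-injective : ∀ {x y} → 𝒞 H x → 𝒞 H y → _~_ H (offTree T x) (offTree T y) → ∀ e → x e ≡ y e
    offTree-injective {x} {y} x∈𝒞 y∈𝒞 x~y e =
      i-j≡0⇒i≡j (x e) (y e) (𝒞-basis.vanishing-on-I⇒zero x-y∈𝒞 x-y≡0-off-T e)
      where
      x-y∈𝒞 : 𝒞 H (λ e → x e - y e)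
      x-y∈𝒞 = IsSubmodule.sub-closed 𝒞-isSubmodule {x} {y} x∈𝒞 y∈𝒞

      restriction≡0 : ∀ e → offTree T x e - offTree T y e ≡ 0ℤ
      restriction≡0 = ℬ-basis.vanishing-on-I⇒zero x~y λ t t∈T →
        cong₂ _-_ (offTree-∈ x t∈T) (offTree-∈ y t∈T)

      x-y≡0-off-T : ∀ e → e ∈ ∁ T → x e - y e ≡ 0ℤ
      x-y≡0-off-T e e∈∁T = let e∉T = x∈∁p⇒x∉p e∈∁T in
        trans (sym (cong₂ _-_ (offTree-∉ x e∉T) (offTree-∉ y e∉T))) (restriction≡0 e)

    offTree-surjective : ∀ c → Σ[ z ∈ C₁ H ] Σ[ z∈𝒞 ∈ 𝒞 H z ] _~_ H (offTree T z) c
    offTree-surjective c = z , z∈𝒞 , IsSubmodule.∈-resp ℬ-isSubmodule -b≗offTree-z-c -b∈ℬ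
      where
      b-ext = ℬ-basis.extend-from-I ℬ-isSubmodule c
      b = proj₁ b-ext
      -b∈ℬ = IsSubmodule.neg-closed ℬ-isSubmodule (proj₁ (proj₂ b-ext))
      z-ext = 𝒞-basis.extend-from-I 𝒞-isSubmodule (λ e → c e - b e)
      z = proj₁ z-ext
      z∈𝒞 = proj₁ (proj₂ z-ext)

      cancel : ∀ (a b : ℤ) → (a - b) - a ≡ - b
      cancel = solve-∀

      -b≗offTree-z-c : ∀ e → - b e ≡ offTree T z e - c e
      -b≗offTree-z-c e with e ∈? T
      ... | yes e∈T = begin
        - b e               ≡⟨ cong -_ (proj₂ (proj₂ b-ext) e e∈T) ⟩
        - c e               ≡⟨ +-identityˡ (- c e) ⟨
        0ℤ - c e            ≡⟨ cong (_- c e) (offTree-∈ z e∈T) ⟨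
        offTree T z e - c e ∎
      ... | no  e∉T = begin
        - b e               ≡⟨ cancel (c e) (b e) ⟨
        (c e - b e) - c e   ≡⟨ cong (_- c e) (proj₂ (proj₂ z-ext) e (x∉p⇒x∈∁p e∉T)) ⟨
        z e - c e           ≡⟨ cong (_- c e) (offTree-∉ z e∉T) ⟨
        offTree T z e - c e ∎

theorem13 : (H : OrientedHypergraph) →
            Σ[ T ∈ Subset (OrientedHypergraph.m H) ] AlgebraicSpanningTree H T →
            H₁≅H¹ H
theorem13 H (T , (xℬ , (xℬ-basis , xℬ-pairing) , (y𝒞 , y𝒞-basis , y𝒞-pairing))) = record
  { f      = λ x _ → offTree H T x
  ; f-cong = λ x _ y _ x≗y → ≗⇒~ H (offTree-cong H T x≗y)
  ; f-hom  = λ x _ y _ z _ z≗x+y → ≗⇒~ H (offTree-+ H T z≗x+y)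
  ; f-inj  = λ x x∈𝒞 y y∈𝒞 → offTree-injective H T xℬ-basis xℬ-dual y𝒞-basis y𝒞-dual x∈𝒞 y∈𝒞
  ; f-surj = offTree-surjective H T xℬ-basis xℬ-dual y𝒞-basis y𝒞-dual
  }
  where
  xℬ-dual = ⟨-,basis₁⟩-dual H (λ _ t∈T → t∈T) xℬ-pairing
  y𝒞-dual = ⟨-,basis₁⟩-dual H (λ _ → x∈∁p⇒x∉p) y𝒞-pairing
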